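{- Let $V$ be a finite set, let $t,q$ be positive integers and set $N=(t!)^2 q^{t+1}$. Let $\mathbf{x}_1,\dots,\mathbf{x}_N\in V^t$ be vectors, each of which has pairwise distinct entries. Then there are indices $i_1<\dots<i_q$ such that, writing $\mathbf{y}_k=\mathbf{x}_{i_k}$ for $k=1,\dots,q$: (i) for each $j=1,\dots,t$, the entries $(\mathbf{y}_1)_j,\dots,(\mathbf{y}_q)_j$ are either all equal or pairwise distinct; and (ii) the sets $Y_j=\{(\mathbf{y}_1)_j,\dots,(\mathbf{y}_q)_j\}$, $j=1,\dots,t$, are pairwise disjoint. -}

module Defs where

open import Data.Nat using (ℕ; _*_; _^_; suc; _!)
open import Data.Fin using (Fin; _<_)
open import Relation.Binary.PropositionalEquality using (_≡_; _≢_)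
open import Data.Sum using (_⊎_)

bound : ℕ → ℕ → ℕ
bound t q = (t !) * (t !) * q ^ (suc t)

DistinctEntries : {V : Set} {t : ℕ} → (Fin t → V) → Set
DistinctEntries {t = t} x = (j j′ : Fin t) → x j ≡ x j′ → j ≡ j′

StrictlyIncreasing : {q N : ℕ} → (Fin q → Fin N) → Set
StrictlyIncreasing {q} i = (k k′ : Fin q) → k < k′ → i k < i k′

AllEqualOrPairwiseDistinct : {V : Set} {q : ℕ} → (Fin q → V) → Set
AllEqualOrPairwiseDistinct {q = q} a =
  ((k k′ : Fin q) → a k ≡ a k′) ⊎ ((k k′ : Fin q) → a k ≡ a k′ → k ≡ k′)

ColumnSetsDisjoint : {V : Set} {q t : ℕ} → (Fin q → Fin t → V) → Set
ColumnSetsDisjoint {q = q} {t} y =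
  (j j′ : Fin t) → j ≢ j′ → (k k′ : Fin q) → y k j ≢ y k′ j′

-- Shrink the set F of unsettled columns while keeping a family L of at least
-- bound s q vectors (|F| ≤ s) that agree on every column outside F; initially F
-- is every column and L every vector.  Call a and b clashing when a_j = b_j′ for
-- some j, j′ ∈ F, and let D be a maximal clash-free subfamily of L.  If |D| ≥ q,
-- any q members of D work: their F-columns are injective and pairwise disjoint,
-- the other columns are constant, and a constant column cannot meet another
-- column since each vector has distinct entries.  Otherwise every member of L
-- clashes with some d ∈ D (itself, if it lies in D), so L is covered by the
-- |D| |F|² classes {n : n_j = d_j′}.  Since bound (s + 1) q = q (s + 1)² bound s q,
-- some class has more than bound s q members; column j is constant on it, so we
-- continue with F ∖ {j}.

module Submission where

open import Defs
open import Data.Nat using (ℕ; NonZero)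
open import Data.Fin using (Fin)
open import Data.Product using (Σ; _×_)

open import Function using (_∘_; id)
open import Data.Empty using (⊥-elim)
open import Data.Nat using (suc; _+_; _*_; _^_; _!; _≤_; _<_; z≤n; s≤s; _≤?_; _<?_; s≤s⁻¹)
open import Data.Nat.Properties
  using (≤-refl; ≤-reflexive; ≤-trans; <-≤-trans; <⇒≤; <⇒≱; ≮⇒≥; ≰⇒>; n≤1+n; +-mono-≤; +-suc;
         *-mono-≤; *-monoˡ-≤; *-monoʳ-≤; *-monoˡ-<; *-assoc; m≤m*n; m≤n*m; m*n≢0; m^n≢0; _!*_!≢0;
         module ≤-Reasoning)
open import Data.Nat.ListAction using (sum)
open import Data.Nat.Tactic.RingSolver using (solve-∀)
open import Data.Fin as Fin using (zero; suc; inject≤)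
open import Data.Fin.Properties using (<-cmp)
open import Data.Product using (_,_; proj₁; proj₂)
open import Data.Sum as Sum using (_⊎_; inj₁; inj₂)
open import Data.List using (List; []; _∷_; _++_; length; map; filter; lookup; cartesianProduct; allFin)
open import Data.List.Properties using (length-++; length-map; length-tabulate; filter-notAll)
open import Data.List.Relation.Unary.All as All using (All; []; _∷_)
open import Data.List.Relation.Unary.All.Properties using (¬Any⇒All¬)
open import Data.List.Relation.Unary.Any as Any using (Any; here; there; any?)
open import Data.List.Relation.Unary.Any.Properties using (swap)
open import Data.List.Relation.Unary.AllPairs as AllPairs using (AllPairs; []; _∷_)
open import Data.List.Relation.Unary.AllPairs.Properties using (tabulate⁺-<)
  renaming (filter⁺ to AllPairs-filter⁺)
open import Data.List.Membership.Propositional using (_∈_; _∉_; find; lose)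
open import Data.List.Membership.Propositional.Properties
  using (∈-lookup; ∈-filter⁺; ∈-filter⁻; ∈-cartesianProduct⁺; ∈-cartesianProduct⁻; ∈-allFin)
open import Relation.Binary using (tri<; tri≈; tri>)
open import Relation.Binary.Definitions using (DecidableEquality)
open import Relation.Binary.PropositionalEquality
  using (_≡_; _≢_; refl; sym; trans; cong; cong₂; module ≡-Reasoning)
open import Relation.Nullary using (¬_; Dec; yes; no; ¬?)
open import Relation.Nullary.Decidable using (decidable-stable)

sum-pigeonhole : {B : Set} (f : B → ℕ) (k : ℕ) (C : List B) →
  length C * k < sum (map f C) → Any (λ c → k < f c) C
sum-pigeonhole f k (c ∷ C) big with k <? f c
... | yes k<fc = here k<fc
... | no  k≮fc = there (sum-pigeonhole f k C
                   (≰⇒> λ small → <⇒≱ big (+-mono-≤ (≮⇒≥ k≮fc) small)))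

module _ {A B : Set} {R : A → B → Set} (R? : ∀ a c → Dec (R a c)) where

  classSize : B → List A → ℕ
  classSize c L = length (filter (λ a → R? a c) L)

  totalClassSize : List B → List A → ℕ
  totalClassSize C L = sum (map (λ c → classSize c L) C)

  classSize-∷ : ∀ a c L → classSize c L ≤ classSize c (a ∷ L)
  classSize-∷ a c L with R? a c
  ... | yes _ = n≤1+n _
  ... | no  _ = ≤-refl

  classSize-∷-related : ∀ {a c} L → R a c → suc (classSize c L) ≤ classSize c (a ∷ L)
  classSize-∷-related {a} {c} L Rac with R? a c
  ... | yes _   = ≤-refl
  ... | no ¬Rac = ⊥-elim (¬Rac Rac)

  totalClassSize-∷ : ∀ a C L → totalClassSize C L ≤ totalClassSize C (a ∷ L)
  totalClassSize-∷ a []      L = z≤n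
  totalClassSize-∷ a (c ∷ C) L = +-mono-≤ (classSize-∷ a c L) (totalClassSize-∷ a C L)

  totalClassSize-∷-covered : ∀ {a} C L → Any (R a) C →
    suc (totalClassSize C L) ≤ totalClassSize C (a ∷ L)
  totalClassSize-∷-covered {a} (c ∷ C) L (here Rac) =
    +-mono-≤ (classSize-∷-related L Rac) (totalClassSize-∷ a C L)
  totalClassSize-∷-covered {a} (c ∷ C) L (there covered) = begin
    suc (classSize c L + totalClassSize C L) ≡⟨ +-suc _ _ ⟨
    classSize c L + suc (totalClassSize C L) ≤⟨ +-mono-≤ (classSize-∷ a c L)
                                                          (totalClassSize-∷-covered C L covered) ⟩
    totalClassSize (c ∷ C) (a ∷ L)           ∎
    where open ≤-Reasoning

  length≤totalClassSize : ∀ C L → All (λ a → Any (R a) C) L → length L ≤ totalClassSize C L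
  length≤totalClassSize C []      []                = z≤n
  length≤totalClassSize C (a ∷ L) (covered ∷ cover) =
    ≤-trans (s≤s (length≤totalClassSize C L cover)) (totalClassSize-∷-covered C L covered)

  pigeonhole : ∀ k C L → All (λ a → Any (R a) C) L → length C * k < length L →
    Any (λ c → k < classSize c L) C
  pigeonhole k C L cover big =
    sum-pigeonhole (λ c → classSize c L) k C (<-≤-trans big (length≤totalClassSize C L cover))

module Greedy {A : Set} {Conflict : A → A → Set} (conflict? : ∀ a b → Dec (Conflict a b)) where

  greedy : List A → List A
  greedy []      = []
  greedy (a ∷ L) with any? (conflict? a) (greedy L)
  ... | yes _ = greedy L
  ... | no  _ = a ∷ greedy L

  greedy-⊆ : ∀ L {a} → a ∈ greedy L → a ∈ L
  greedy-⊆ (b ∷ L) a∈ with any? (conflict? b) (greedy L)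
  greedy-⊆ (b ∷ L) a∈          | yes _ = there (greedy-⊆ L a∈)
  greedy-⊆ (b ∷ L) (here refl) | no  _ = here refl
  greedy-⊆ (b ∷ L) (there a∈)  | no  _ = there (greedy-⊆ L a∈)

  greedy-allPairs : ∀ {R : A → A → Set} {L} → AllPairs R L →
    AllPairs (λ a b → R a b × ¬ Conflict a b) (greedy L)
  greedy-allPairs {L = []}    []        = []
  greedy-allPairs {L = a ∷ L} (Ra ∷ RL) with any? (conflict? a) (greedy L)
  ... | yes _          = greedy-allPairs RL
  ... | no  noConflict =
    All.zip (All.tabulate (All.lookup Ra ∘ greedy-⊆ L) , ¬Any⇒All¬ (greedy L) noConflict)
      ∷ greedy-allPairs RL

  greedy-maximal : ∀ L {a} → a ∈ L → a ∈ greedy L ⊎ Any (Conflict a) (greedy L)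
  greedy-maximal (b ∷ L) a∈ with any? (conflict? b) (greedy L)
  greedy-maximal (b ∷ L) (here refl) | yes conflict = inj₂ conflict
  greedy-maximal (b ∷ L) (here refl) | no  _        = inj₁ (here refl)
  greedy-maximal (b ∷ L) (there a∈)  | yes _        = greedy-maximal L a∈
  greedy-maximal (b ∷ L) (there a∈)  | no  _        = Sum.map there there (greedy-maximal L a∈)

AllPairs-lookup-inject≤ : ∀ {A : Set} {R : A → A → Set} {q E} (q≤ : q ≤ length E) →
  AllPairs R E → ∀ {k k′} → k Fin.< k′ → R (lookup E (inject≤ k q≤)) (lookup E (inject≤ k′ q≤))
AllPairs-lookup-inject≤ {E = _ ∷ _} (s≤s q≤) (Ra ∷ _)  {zero}  {suc k′} _ =
  All.lookup Ra (∈-lookup _)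
AllPairs-lookup-inject≤ {E = _ ∷ _} (s≤s q≤) (_ ∷ RE) {suc k} {suc k′} (s≤s k<k′) =
  AllPairs-lookup-inject≤ q≤ RE k<k′

Any-cartesianProduct⁺ : ∀ {A B : Set} {P : A × B → Set} xs ys →
  Any (λ a → Any (λ b → P (a , b)) ys) xs → Any P (cartesianProduct xs ys)
Any-cartesianProduct⁺ xs ys p =
  let a , a∈ , pa = find p
      b , b∈ , pab = find pa
  in lose (∈-cartesianProduct⁺ a∈ b∈) pab

length-cartesianProduct : ∀ {A B : Set} (xs : List A) (ys : List B) →
  length (cartesianProduct xs ys) ≡ length xs * length ys
length-cartesianProduct []       ys = refl
length-cartesianProduct (a ∷ xs) ys = begin
  length (map (a ,_) ys ++ cartesianProduct xs ys)         ≡⟨ length-++ (map (a ,_) ys) ⟩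
  length (map (a ,_) ys) + length (cartesianProduct xs ys) ≡⟨ cong₂ _+_ (length-map (a ,_) ys)
                                                                        (length-cartesianProduct xs ys) ⟩
  length ys + length xs * length ys                        ∎
  where open ≡-Reasoning

bound-nonZero : ∀ s q .{{_ : NonZero q}} → NonZero (bound s q)
bound-nonZero s q = m*n≢0 (s ! * s !) (q ^ suc s) {{s !* s !≢0}} {{m^n≢0 q (suc s)}}

q≤bound : ∀ s q .{{_ : NonZero q}} → q ≤ bound s q
q≤bound s q =
  ≤-trans (m≤m*n q (q ^ s) {{m^n≢0 q s}}) (m≤n*m (q ^ suc s) (s ! * s !) {{s !* s !≢0}})

bound-suc : ∀ s q → bound (suc s) q ≡ q * (suc s * suc s * bound s q)
bound-suc s q = rearrange (suc s) (s !) q (q ^ s)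
  where
  rearrange : ∀ a b c d → a * b * (a * b) * (c * (c * d)) ≡ c * (a * a * (b * b * (c * d)))
  rearrange = solve-∀

m*[n*n]*bound<bound-suc : ∀ {s q m n} .{{_ : NonZero q}} → m < q → n ≤ suc s →
  m * (n * n) * bound s q < bound (suc s) q
m*[n*n]*bound<bound-suc {s} {q} {m} {n} m<q n≤ = begin-strict
  m * (n * n) * bound s q             ≤⟨ *-monoˡ-≤ (bound s q) (*-monoʳ-≤ m (*-mono-≤ n≤ n≤)) ⟩
  m * (suc s * suc s) * bound s q     ≡⟨ *-assoc m _ _ ⟩
  m * (suc s * suc s * bound s q)     <⟨ *-monoˡ-< _ {{m*n≢0 (suc s * suc s) (bound s q)
                                                          {{_}} {{bound-nonZero s q}}}} m<q ⟩
  q * (suc s * suc s * bound s q)     ≡⟨ bound-suc s q ⟨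
  bound (suc s) q                     ∎
  where open ≤-Reasoning

module _ {V : Set} (_≟_ : DecidableEquality V) {N t : ℕ} (x : Fin N → Fin t → V) where

  open import Data.List.Membership.DecPropositional (Fin._≟_ {t}) using (_∈?_)

  Clash : List (Fin t) → Fin N → Fin N → Set
  Clash F a b = Any (λ j → Any (λ j′ → x a j ≡ x b j′) F) F

  clash? : ∀ F a b → Dec (Clash F a b)
  clash? F a b = any? (λ j → any? (λ j′ → x a j ≟ x b j′) F) F

  clash : ∀ {F a b j j′} → j ∈ F → j′ ∈ F → x a j ≡ x b j′ → Clash F a b
  clash j∈F j′∈F eq = lose j∈F (lose j′∈F eq)

  clash-sym : ∀ {F a b} → Clash F a b → Clash F b a
  clash-sym = Any.map (Any.map sym) ∘ swap

  AgreeOutside : List (Fin t) → List (Fin N) → Set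
  AgreeOutside F L = ∀ j → j ∉ F → ∀ {a b} → a ∈ L → b ∈ L → x a j ≡ x b j

  agreeOutside-⊆ : ∀ {F L L′} → (∀ {a} → a ∈ L′ → a ∈ L) → AgreeOutside F L → AgreeOutside F L′
  agreeOutside-⊆ L′⊆L agree j j∉F a∈ b∈ = agree j j∉F (L′⊆L a∈) (L′⊆L b∈)

  remove : Fin t → List (Fin t) → List (Fin t)
  remove j = filter (λ j₁ → ¬? (j₁ Fin.≟ j))

  length-remove< : ∀ {j F} → j ∈ F → length (remove j F) < length F
  length-remove< {j} {F} j∈F =
    filter-notAll (λ j₁ → ¬? (j₁ Fin.≟ j)) F (Any.map (λ j≡ j≢ → j≢ (sym j≡)) j∈F)

  agreeOutside-remove : ∀ {F L} j w → AgreeOutside F L →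
    AgreeOutside (remove j F) (filter (λ a → x a j ≟ w) L)
  agreeOutside-remove {F} {L} j w agree j₁ j₁∉F′ a∈ b∈ = column j₁ j₁∉F′ (member a∈) (member b∈)
    where
    member : ∀ {a} → a ∈ filter (λ a → x a j ≟ w) L → a ∈ L × x a j ≡ w
    member = ∈-filter⁻ (λ a → x a j ≟ w) {xs = L}

    column : ∀ j₁ → j₁ ∉ remove j F → ∀ {a b} → a ∈ L × x a j ≡ w → b ∈ L × x b j ≡ w →
      x a j₁ ≡ x b j₁
    column j₁ j₁∉F′ (a∈ , a≡w) (b∈ , b≡w) with j₁ Fin.≟ j
    ... | yes refl = trans a≡w (sym b≡w)
    ... | no  j₁≢j = agree j₁ (λ j₁∈F → j₁∉F′ (∈-filter⁺ _ j₁∈F j₁≢j)) a∈ b∈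

  Colour : Fin N → Fin N × Fin t × Fin t → Set
  Colour n (d , j , j′) = x n j ≡ x d j′

  colour? : ∀ n c → Dec (Colour n c)
  colour? n (d , j , j′) = x n j ≟ x d j′

  colours : List (Fin N) → List (Fin t) → List (Fin N × Fin t × Fin t)
  colours D F = cartesianProduct D (cartesianProduct F F)

  length-colours : ∀ D F → length (colours D F) ≡ length D * (length F * length F)
  length-colours D F = trans (length-cartesianProduct D (cartesianProduct F F))
                             (cong (length D *_) (length-cartesianProduct F F))

  ∈-colours⁻ : ∀ D F {d j j′} → (d , j , j′) ∈ colours D F → d ∈ D × j ∈ F × j′ ∈ F
  ∈-colours⁻ D F c∈ =
    let d∈D , jj′∈F² = ∈-cartesianProduct⁻ D (cartesianProduct F F) c∈
    in d∈D , ∈-cartesianProduct⁻ F F jj′∈F²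

  open Greedy

  coloured : ∀ j₀ F L {n} → n ∈ L → Any (Colour n) (colours (greedy (clash? (j₀ ∷ F)) L) (j₀ ∷ F))
  coloured j₀ F L {n} n∈L =
    Any-cartesianProduct⁺ D (cartesianProduct F′ F′) (Any.map (Any-cartesianProduct⁺ F′ F′)
      (Sum.[ clashSelf , id ]′ (greedy-maximal (clash? F′) L n∈L)))
    where
    F′ = j₀ ∷ F
    D = greedy (clash? F′) L

    clashSelf : n ∈ D → Any (Clash F′ n) D
    clashSelf n∈D = lose n∈D (clash (here refl) (here refl) refl)

  GoodSubsequence : ℕ → Set
  GoodSubsequence q = Σ (Fin q → Fin N) λ i →
    StrictlyIncreasing i ×
    ((j : Fin t) → AllEqualOrPairwiseDistinct (λ k → x (i k) j)) ×
    ColumnSetsDisjoint (λ k j → x (i k) j)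

  module _ (distinct : ∀ n → DistinctEntries (x n)) where

    goodSubsequence : ∀ {q F} (i : Fin q → Fin N) → StrictlyIncreasing i →
      (∀ {k k′} → k ≢ k′ → ¬ Clash F (i k) (i k′)) →
      (∀ j → j ∉ F → ∀ k k′ → x (i k) j ≡ x (i k′) j) →
      GoodSubsequence q
    goodSubsequence {F = F} i increasing separated agree = i , increasing , columns , disjoint
      where
      columns : (j : Fin t) → AllEqualOrPairwiseDistinct (λ k → x (i k) j)
      columns j with j ∈? F
      ... | no  j∉F = inj₁ (agree j j∉F)
      ... | yes j∈F = inj₂ λ k k′ eq →
        decidable-stable (k Fin.≟ k′) λ k≢k′ → separated k≢k′ (clash j∈F j∈F eq)

      disjoint : ColumnSetsDisjoint (λ k j → x (i k) j)
      disjoint j j′ j≢j′ k k′ eq with k Fin.≟ k′ | j ∈? F | j′ ∈? F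
      ... | yes refl   | _       | _        = j≢j′ (distinct (i k) j j′ eq)
      ... | no  _      | no j∉F  | _        = j≢j′ (distinct (i k′) j j′ (trans (agree j j∉F k′ k) eq))
      ... | no  _      | yes _   | no j′∉F  = j≢j′ (distinct (i k) j j′ (trans eq (agree j′ j′∉F k′ k)))
      ... | no  k≢k′   | yes j∈F | yes j′∈F = separated k≢k′ (clash j∈F j′∈F eq)

    clashFree⇒goodSubsequence : ∀ {q F E} → AllPairs (λ a b → a Fin.< b × ¬ Clash F a b) E →
      AgreeOutside F E → q ≤ length E → GoodSubsequence q
    clashFree⇒goodSubsequence {q} {F} {E} pairs agree q≤ =
      goodSubsequence i (λ _ _ → proj₁ ∘ ordered) separated
        (λ j j∉F _ _ → agree j j∉F (∈-lookup _) (∈-lookup _))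
      where
      i : Fin q → Fin N
      i k = lookup E (inject≤ k q≤)

      ordered : ∀ {k k′} → k Fin.< k′ → i k Fin.< i k′ × ¬ Clash F (i k) (i k′)
      ordered = AllPairs-lookup-inject≤ q≤ pairs

      separated : ∀ {k k′} → k ≢ k′ → ¬ Clash F (i k) (i k′)
      separated {k} {k′} k≢k′ with <-cmp k k′
      ... | tri< k<k′ _ _ = proj₂ (ordered k<k′)
      ... | tri≈ _ k≡k′ _ = ⊥-elim (k≢k′ k≡k′)
      ... | tri> _ _ k′<k = proj₂ (ordered k′<k) ∘ clash-sym

    module _ (q : ℕ) .⦃ _ : NonZero q ⦄ where

      denseColourClass : ∀ s j₀ F L → let D = greedy (clash? (j₀ ∷ F)) L in
        length (j₀ ∷ F) ≤ suc s → length D < q → bound (suc s) q ≤ length L →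
        Any (λ c → bound s q < classSize colour? c L) (colours D (j₀ ∷ F))
      denseColourClass s j₀ F L |F|≤ |D|<q big =
        pigeonhole colour? (bound s q) (colours D F′) L (All.tabulate (coloured j₀ F L)) (begin-strict
          length (colours D F′) * bound s q              ≡⟨ cong (_* bound s q) (length-colours D F′) ⟩
          length D * (length F′ * length F′) * bound s q <⟨ m*[n*n]*bound<bound-suc |D|<q |F|≤ ⟩
          bound (suc s) q                                ≤⟨ big ⟩
          length L                                       ∎)
        where
        open ≤-Reasoning
        F′ = j₀ ∷ F
        D = greedy (clash? F′) L

      select : ∀ s F L → length F ≤ s → AllPairs Fin._<_ L → AgreeOutside F L →
        bound s q ≤ length L → GoodSubsequence q
      select s [] L _ sorted agree big =
        clashFree⇒goodSubsequence (AllPairs.map (_, λ ()) sorted) agree (≤-trans (q≤bound s q) big)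
      select (suc s) F@(j₀ ∷ F₀) L |F|≤ sorted agree big with q ≤? length (greedy (clash? F) L)
      ... | yes q≤|D| =
        clashFree⇒goodSubsequence (greedy-allPairs (clash? F) sorted)
          (agreeOutside-⊆ (greedy-⊆ (clash? F) L) agree) q≤|D|
      ... | no q≰|D| with find (denseColourClass s j₀ F₀ L |F|≤ (≰⇒> q≰|D|) big)
      ... | (d , j , j′) , c∈ , dense =
        select s (remove j F) (filter (λ n → x n j ≟ x d j′) L)
          (s≤s⁻¹ (≤-trans (length-remove< j∈F) |F|≤))
          (AllPairs-filter⁺ _ sorted) (agreeOutside-remove j (x d j′) agree) (<⇒≤ dense)
        where
        j∈F : j ∈ F
        j∈F = proj₁ (proj₂ (∈-colours⁻ (greedy (clash? F) L) F c∈))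

lemma3p3 : (v t q : ℕ) → .{{_ : NonZero t}} → .{{_ : NonZero q}} →
    (x : Fin (bound t q) → Fin t → Fin v) →
    ((n : Fin (bound t q)) → DistinctEntries (x n)) →
    Σ (Fin q → Fin (bound t q)) (λ i →
      StrictlyIncreasing i ×
      ((j : Fin t) → AllEqualOrPairwiseDistinct (λ k → x (i k) j)) ×
      ColumnSetsDisjoint (λ k j → x (i k) j))
lemma3p3 v t q x distinct =
  select Fin._≟_ x distinct q t (allFin t) (allFin (bound t q))
    (≤-reflexive (length-tabulate id)) (tabulate⁺-< id)
    (λ j j∉ → ⊥-elim (j∉ (∈-allFin j))) (≤-reflexive (sym (length-tabulate id)))
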